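{- Let $m\geqslant 2$ and let $a_0,a_1,\dots,a_{2m}$ be integers with $a_1,\dots,a_{2m-1}\geqslant 1$ and $a_0,a_{2m}\geqslant 0$, such that the binary word $$W=\mathtt{0}^{a_0}\mathtt{1}\mathtt{0}^{a_1}\mathtt{1}\mathtt{0}^{a_2}\cdots\mathtt{1}\mathtt{0}^{a_{2m}}$$ is even. Then $W$ is a shuffle square with alternating $\mathtt1$'s if and only if the system $$r_0=\tfrac12(a_0+a_1-r_1),\qquad r_{2i}=\tfrac12(a_{2i}+a_{2i+1}-r_{2i-1}-r_{2i+1})\ (1\leqslant i\leqslant m-1),\qquad r_{2m}=\tfrac12(a_{2m}-r_{2m-1})$$ admits an integer solution $(r_0,r_1,\dots,r_{2m})$ with $0\leqslant r_i\leqslant a_i$ for all $i$. In that case, writing $\ell_i=a_i-r_i$, $W$ has perfect twins of the form $$\mathtt0^{r_0}\mathtt1\mathtt0^{r_1+r_2}\mathtt1\mathtt0^{r_3+r_4}\cdots\mathtt1\mathtt0^{r_{2m-1}+r_{2m}}=\mathtt0^{\ell_0+\ell_1}\mathtt1\mathtt0^{\ell_2+\ell_3}\mathtt1\cdots\mathtt1\mathtt0^{\ell_{2m}}.$$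
   Context: $w^r$ denotes $r$ consecutive copies of the letter $w$. A word is even if each letter occurs an even number of times. Perfect twins in $W$ are two subsequences $X,Y$ of $W$ that are equal as words and whose supports (sets of positions) partition the set of all positions of $W$; $W$ is a shuffle square if it has perfect twins. $W$ is a shuffle square with alternating $\mathtt1$'s if it has perfect twins $X,Y$ such that the occurrences of $\mathtt1$ in $W$, read from left to right, belong alternately to $X$ and to $Y$. -}

module Defs where

open import Data.Bool using (Bool; true; false)
open import Data.Bool.Properties using () renaming (_≟_ to _≟ᵇ_)
open import Data.Nat using (ℕ; zero; suc; _+_; _*_; _∸_; _≤_)
open import Data.Nat.Divisibility using (_∣_)
open import Data.List using (List; []; _∷_; _++_; replicate; concatMap; upTo; length; filter)
open import Data.Vec using (Vec; []; _∷_)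
open import Data.Unit using (⊤)
open import Data.Product using (Σ; _×_; _,_)
open import Relation.Binary.PropositionalEquality using (_≡_; _≢_)
open import Relation.Binary.Definitions using (DecidableEquality)

Bit : Set
Bit = Bool

𝟎 𝟏 : Bit
𝟎 = false
𝟏 = true

Word : Set
Word = List Bit

IsEven : Word → Set
IsEven w = (x : Bit) → 2 ∣ length (filter (_≟ᵇ x) w)

-- Two subsequences whose supports partition the positions of w are
-- encoded by a colouring of the positions: colour true = in X, false = in Y.
Colouring : Word → Set
Colouring w = Vec Bool (length w)

pick : (w : Word) → Colouring w → Bool → Word
pick [] [] b = []
pick (x ∷ w) (true ∷ c) true = x ∷ pick w c true
pick (x ∷ w) (false ∷ c) false = x ∷ pick w c false
pick (x ∷ w) (true ∷ c) false = pick w c false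
pick (x ∷ w) (false ∷ c) true = pick w c true

PerfectTwins : (w : Word) → Colouring w → Set
PerfectTwins w c = pick w c true ≡ pick w c false

ShuffleSquare : Word → Set
ShuffleSquare w = Σ (Colouring w) (PerfectTwins w)

onesColours : (w : Word) → Colouring w → List Bool
onesColours [] [] = []
onesColours (true ∷ w) (b ∷ c) = b ∷ onesColours w c
onesColours (false ∷ w) (b ∷ c) = onesColours w c

Alternating : List Bool → Set
Alternating [] = ⊤
Alternating (x ∷ []) = ⊤
Alternating (x ∷ y ∷ l) = x ≢ y × Alternating (y ∷ l)

ShuffleSquareAlt1 : Word → Set
ShuffleSquareAlt1 w =
  Σ (Colouring w) λ c → PerfectTwins w c × Alternating (onesColours w c)

W : ℕ → (ℕ → ℕ) → Word
W m a = replicate (a 0) 𝟎 ++ concatMap (λ j → 𝟏 ∷ replicate (a (suc j)) 𝟎) (upTo (2 * m))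

-- the linear system, with the halves cleared (2 r_i + ... = ...), r_i ∈ ℕ, 0 ≤ r_i ≤ a_i
System : ℕ → (ℕ → ℕ) → (ℕ → ℕ) → Set
System m a r =
    ((i : ℕ) → i ≤ 2 * m → r i ≤ a i)
  × (2 * r 0 + r 1 ≡ a 0 + a 1)
  × ((i : ℕ) → 1 ≤ i → i ≤ m ∸ 1 →
       2 * r (2 * i) + r (2 * i ∸ 1) + r (2 * i + 1) ≡ a (2 * i) + a (2 * i + 1))
  × (2 * r (2 * m) + r (2 * m ∸ 1) ≡ a (2 * m))

rForm : ℕ → (ℕ → ℕ) → Word
rForm m r = replicate (r 0) 𝟎
  ++ concatMap (λ i → 𝟏 ∷ replicate (r (2 * i + 1) + r (2 * i + 2)) 𝟎) (upTo m)

lForm : ℕ → (ℕ → ℕ) → Word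
lForm m l = replicate (l 0 + l 1) 𝟎
  ++ concatMap (λ i → 𝟏 ∷ replicate (l (2 * i + 2) + l (2 * i + 3)) 𝟎) (upTo (m ∸ 1))
  ++ 𝟏 ∷ replicate (l (2 * m)) 𝟎

-- Colour the 1s of W alternately, the first one with colour s. Whatever the colours of the zeros,
-- if x i and y i count the zeros of the i-th run of W coloured s and not s, the two colour classes are
--   X = 0^x₀ 1 0^(x₁+x₂) 1 … 1 0^(x₂ₘ₋₁+x₂ₘ)   and   Y = 0^(y₀+y₁) 1 0^(y₂+y₃) 1 … 1 0^y₂ₘ,
-- and conversely every split x i + y i = a i of the runs comes from such a colouring. A binary word is
-- determined by its runs of zeros, so X = Y says r₀ = ℓ₀ + ℓ₁, r₂ᵢ₋₁ + r₂ᵢ = ℓ₂ᵢ + ℓ₂ᵢ₊₁ and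
-- r₂ₘ₋₁ + r₂ₘ = ℓ₂ₘ for r = x and ℓ = y = a − r: the system with its halves cleared.
module Submission where

open import Defs
open import Data.Bool using (Bool; true; false; not)
open import Data.Bool.Properties using (not-involutive; not-¬; ¬-not) renaming (_≟_ to _≟ᵇ_)
open import Data.Nat using (ℕ; zero; suc; _+_; _*_; _∸_; _≤_; _<_; z≤n; s≤s)
open import Data.Nat.Properties
  using (*-suc; +-comm; +-suc; +-cancelʳ-≡; m≤m+n; m+[n∸m]≡n; m+n∸m≡n; m∸n+n≡m; *-monoʳ-≤; m≤n⇒m≤1+n; ≤-refl)
open import Data.Nat.Tactic.RingSolver using (solve-∀)
open import Data.List using (List; []; _∷_; _++_; _∷ʳ_; [_]; map; replicate; concatMap; upTo; applyUpTo)
open import Data.List.Properties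
  using (++-assoc; ++-identityʳ; ∷-injective; ∷ʳ-injective; map-cong; map-++; map-upTo;
         map-applyUpTo; upTo-∷ʳ; concatMap-map; concatMap-++)
open import Data.Vec using ([]; _∷_)
open import Data.Product using (Σ; _×_; _,_; proj₁; proj₂)
open import Data.Unit using (⊤; tt)
open import Function using (_∘_)
open import Function.Bundles using (_⇔_; mk⇔; Equivalence)
open import Relation.Binary.PropositionalEquality hiding ([_])
open import Relation.Nullary using (yes; no)

map-upTo-suc : ∀ {A : Set} (f : ℕ → A) n → map f (upTo (suc n)) ≡ f 0 ∷ map (f ∘ suc) (upTo n)
map-upTo-suc f n = cong (f 0 ∷_) (trans (map-applyUpTo suc f n) (sym (map-upTo (f ∘ suc) n)))

map-upTo-∷ʳ : ∀ {A : Set} (f : ℕ → A) n → map f (upTo (suc n)) ≡ map f (upTo n) ∷ʳ f n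
map-upTo-∷ʳ f n = trans (cong (map f) (sym (upTo-∷ʳ n))) (map-++ f (upTo n) [ n ])

applyUpTo-≡⇔ : ∀ {A : Set} (f g : ℕ → A) n → applyUpTo f n ≡ applyUpTo g n ⇔ (∀ i → i < n → f i ≡ g i)
applyUpTo-≡⇔ f g zero    = mk⇔ (λ _ _ ()) (λ _ → refl)
applyUpTo-≡⇔ f g (suc n) = mk⇔ to from
  where
  ih : applyUpTo (f ∘ suc) n ≡ applyUpTo (g ∘ suc) n ⇔ (∀ i → i < n → f (suc i) ≡ g (suc i))
  ih = applyUpTo-≡⇔ (f ∘ suc) (g ∘ suc) n
  to : applyUpTo f (suc n) ≡ applyUpTo g (suc n) → ∀ i → i < suc n → f i ≡ g i
  to eq zero    _         = proj₁ (∷-injective eq)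
  to eq (suc i) (s≤s i<n) = Equivalence.to ih (proj₂ (∷-injective eq)) i i<n
  from : (∀ i → i < suc n → f i ≡ g i) → applyUpTo f (suc n) ≡ applyUpTo g (suc n)
  from f≡g = cong₂ _∷_ (f≡g 0 (s≤s z≤n)) (Equivalence.from ih (λ i i<n → f≡g (suc i) (s≤s i<n)))

map-upTo-≡⇔ : ∀ {A : Set} (f g : ℕ → A) n → map f (upTo n) ≡ map g (upTo n) ⇔ (∀ i → i < n → f i ≡ g i)
map-upTo-≡⇔ f g n rewrite map-upTo f n | map-upTo g n = applyUpTo-≡⇔ f g n

zeros : ℕ → Word
zeros n = replicate n 𝟎

zeros-+ : ∀ m n → zeros (m + n) ≡ zeros m ++ zeros n
zeros-+ zero    n = refl
zeros-+ (suc m) n = cong (𝟎 ∷_) (zeros-+ m n)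

oneZeros : ℕ → Word
oneZeros k = 𝟏 ∷ zeros k

fromRuns : ℕ → List ℕ → Word
fromRuns p ks = zeros p ++ concatMap oneZeros ks

fromRuns-injective : ∀ p q ks ls → fromRuns p ks ≡ fromRuns q ls → p ≡ q × ks ≡ ls
fromRuns-injective zero    zero    []       []       _  = refl , refl
fromRuns-injective zero    zero    (k ∷ ks) (l ∷ ls) eq
  with refl , refl ← fromRuns-injective k l ks ls (proj₂ (∷-injective eq)) = refl , refl
fromRuns-injective zero    zero    []       (_ ∷ _)  ()
fromRuns-injective zero    zero    (_ ∷ _)  []       ()
fromRuns-injective zero    (suc _) []       _        ()
fromRuns-injective zero    (suc _) (_ ∷ _)  _        ()
fromRuns-injective (suc _) zero    _        []       ()
fromRuns-injective (suc _) zero    _        (_ ∷ _)  ()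
fromRuns-injective (suc p) (suc q) ks       ls       eq
  with refl , refl ← fromRuns-injective p q ks ls (proj₂ (∷-injective eq)) = refl , refl

fromRuns-+ : ∀ p q ks → fromRuns (p + q) ks ≡ zeros p ++ fromRuns q ks
fromRuns-+ p q ks = trans (cong (_++ _) (zeros-+ p q)) (++-assoc (zeros p) (zeros q) _)

fromRuns-∷ʳ : ∀ p ks k → fromRuns p (ks ∷ʳ k) ≡ fromRuns p ks ++ 𝟏 ∷ zeros k
fromRuns-∷ʳ p ks k = begin
  zeros p ++ concatMap oneZeros (ks ++ [ k ])             ≡⟨ cong (zeros p ++_) (concatMap-++ oneZeros ks [ k ]) ⟩
  zeros p ++ concatMap oneZeros ks ++ 𝟏 ∷ zeros k ++ []
    ≡⟨ cong (λ w → zeros p ++ concatMap oneZeros ks ++ 𝟏 ∷ w) (++-identityʳ _) ⟩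
  zeros p ++ concatMap oneZeros ks ++ 𝟏 ∷ zeros k        ≡⟨ ++-assoc (zeros p) _ _ ⟨
  fromRuns p ks ++ 𝟏 ∷ zeros k                     ∎
  where open ≡-Reasoning

runs : ℕ → (ℕ → ℕ) → Word
runs zero    f = zeros (f 0)
runs (suc n) f = zeros (f 0) ++ 𝟏 ∷ runs n (f ∘ suc)

-- runs n f keeping only the 1s after the runs of even index (b = true) or of odd index (b = false)
halfRuns : Bool → ℕ → (ℕ → ℕ) → Word
halfRuns _     zero    f = zeros (f 0)
halfRuns true  (suc n) f = zeros (f 0) ++ 𝟏 ∷ halfRuns false n (f ∘ suc)
halfRuns false (suc n) f = zeros (f 0) ++ halfRuns true n (f ∘ suc)

halfRuns-cong : ∀ b n {f g : ℕ → ℕ} → (∀ i → i ≤ n → f i ≡ g i) → halfRuns b n f ≡ halfRuns b n g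
halfRuns-cong b     zero    f≡g = cong zeros (f≡g 0 z≤n)
halfRuns-cong true  (suc n) f≡g =
  cong₂ (λ k w → zeros k ++ 𝟏 ∷ w) (f≡g 0 z≤n) (halfRuns-cong false n (λ i i≤n → f≡g (suc i) (s≤s i≤n)))
halfRuns-cong false (suc n) f≡g =
  cong₂ (λ k w → zeros k ++ w) (f≡g 0 z≤n) (halfRuns-cong true n (λ i i≤n → f≡g (suc i) (s≤s i≤n)))

runs-fromRuns : ∀ n f → runs n f ≡ fromRuns (f 0) (map (f ∘ suc) (upTo n))
runs-fromRuns zero    f = sym (++-identityʳ _)
runs-fromRuns (suc n) f = trans (cong (λ w → zeros (f 0) ++ 𝟏 ∷ w) (runs-fromRuns n (f ∘ suc)))
                                (cong (fromRuns (f 0)) (sym (map-upTo-suc (f ∘ suc) n)))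

W-runs : ∀ m a → W m a ≡ runs (2 * m) a
W-runs m a = trans (cong (zeros (a 0) ++_) (sym (concatMap-map oneZeros (a ∘ suc) (upTo (2 * m)))))
                   (sym (runs-fromRuns (2 * m) a))

oddEvenPair evenOddPair : (ℕ → ℕ) → ℕ → ℕ
oddEvenPair x i = x (2 * i + 1) + x (2 * i + 2)
evenOddPair y i = y (2 * i + 2) + y (2 * i + 3)

rForm-fromRuns : ∀ m x → rForm m x ≡ fromRuns (x 0) (map (oddEvenPair x) (upTo m))
rForm-fromRuns m x = cong (zeros (x 0) ++_) (sym (concatMap-map oneZeros (oddEvenPair x) (upTo m)))

lForm-fromRuns : ∀ m y → lForm (suc m) y ≡ fromRuns (y 0 + y 1) (map (evenOddPair y) (upTo m) ∷ʳ y (2 * suc m))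
lForm-fromRuns m y = begin
  lForm (suc m) y
    ≡⟨ ++-assoc (zeros (y 0 + y 1)) _ _ ⟨
  (zeros (y 0 + y 1) ++ concatMap (oneZeros ∘ evenOddPair y) (upTo m)) ++ 𝟏 ∷ zeros (y (2 * suc m))
    ≡⟨ cong (λ w → (zeros (y 0 + y 1) ++ w) ++ 𝟏 ∷ zeros (y (2 * suc m)))
            (concatMap-map oneZeros (evenOddPair y) (upTo m)) ⟨
  fromRuns (y 0 + y 1) (map (evenOddPair y) (upTo m)) ++ 𝟏 ∷ zeros (y (2 * suc m))
    ≡⟨ fromRuns-∷ʳ (y 0 + y 1) (map (evenOddPair y) (upTo m)) (y (2 * suc m)) ⟨
  fromRuns (y 0 + y 1) (map (evenOddPair y) (upTo m) ∷ʳ y (2 * suc m)) ∎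
  where open ≡-Reasoning

halfRuns-rForm : ∀ m x → halfRuns true (2 * m) x ≡ rForm m x
halfRuns-rForm m x = trans (halfRuns-fromRuns m x) (sym (rForm-fromRuns m x))
  where
  open ≡-Reasoning
  halfRuns-fromRuns : ∀ m x → halfRuns true (2 * m) x ≡ fromRuns (x 0) (map (oddEvenPair x) (upTo m))
  halfRuns-fromRuns zero    x = sym (++-identityʳ _)
  halfRuns-fromRuns (suc m) x = begin
    halfRuns true (2 * suc m) x
      ≡⟨ cong (λ n → halfRuns true n x) (*-suc 2 m) ⟩
    zeros (x 0) ++ 𝟏 ∷ zeros (x 1) ++ halfRuns true (2 * m) x₂
      ≡⟨ cong (λ w → zeros (x 0) ++ 𝟏 ∷ zeros (x 1) ++ w) (halfRuns-fromRuns m x₂) ⟩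
    zeros (x 0) ++ 𝟏 ∷ zeros (x 1) ++ fromRuns (x 2) pairs₂
      ≡⟨ cong (λ w → zeros (x 0) ++ 𝟏 ∷ w) (fromRuns-+ (x 1) (x 2) pairs₂) ⟨
    fromRuns (x 0) (x 1 + x 2 ∷ pairs₂)
      ≡⟨ cong (λ ps → fromRuns (x 0) (x 1 + x 2 ∷ ps)) (map-cong shift (upTo m)) ⟨
    fromRuns (x 0) (x 1 + x 2 ∷ map (oddEvenPair x ∘ suc) (upTo m))
      ≡⟨ cong (fromRuns (x 0)) (map-upTo-suc (oddEvenPair x) m) ⟨
    fromRuns (x 0) (map (oddEvenPair x) (upTo (suc m))) ∎
    where
    x₂ : ℕ → ℕ
    x₂ i = x (2 + i)
    pairs₂ : List ℕ
    pairs₂ = map (oddEvenPair x₂) (upTo m)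
    shift : ∀ i → oddEvenPair x (suc i) ≡ oddEvenPair x₂ i
    shift i = cong (λ k → x (k + 1) + x (k + 2)) (*-suc 2 i)

halfRuns-lForm : ∀ m y → halfRuns false (2 * suc m) y ≡ lForm (suc m) y
halfRuns-lForm m y = trans (halfRuns-fromRuns m y) (sym (lForm-fromRuns m y))
  where
  open ≡-Reasoning
  halfRuns-fromRuns : ∀ m y →
    halfRuns false (2 * suc m) y ≡ fromRuns (y 0 + y 1) (map (evenOddPair y) (upTo m) ∷ʳ y (2 * suc m))
  halfRuns-fromRuns zero    y = begin
    zeros (y 0) ++ zeros (y 1) ++ 𝟏 ∷ zeros (y 2)
      ≡⟨ cong (λ w → zeros (y 0) ++ zeros (y 1) ++ 𝟏 ∷ w) (++-identityʳ _) ⟨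
    zeros (y 0) ++ fromRuns (y 1) [ y 2 ]
      ≡⟨ fromRuns-+ (y 0) (y 1) [ y 2 ] ⟨
    fromRuns (y 0 + y 1) [ y 2 ] ∎
  halfRuns-fromRuns (suc m) y = begin
    halfRuns false (2 * suc (suc m)) y
      ≡⟨ cong (λ n → halfRuns false n y) (*-suc 2 (suc m)) ⟩
    zeros (y 0) ++ zeros (y 1) ++ 𝟏 ∷ halfRuns false (2 * suc m) y₂
      ≡⟨ cong (λ w → zeros (y 0) ++ zeros (y 1) ++ 𝟏 ∷ w) (halfRuns-fromRuns m y₂) ⟩
    zeros (y 0) ++ zeros (y 1) ++ 𝟏 ∷ fromRuns (y 2 + y 3) (pairs₂ ∷ʳ y (2 + 2 * suc m))
      ≡⟨ fromRuns-+ (y 0) (y 1) (y 2 + y 3 ∷ pairs₂ ∷ʳ y (2 + 2 * suc m)) ⟨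
    fromRuns (y 0 + y 1) (y 2 + y 3 ∷ pairs₂ ∷ʳ y (2 + 2 * suc m))
      ≡⟨ cong₂ (λ ps k → fromRuns (y 0 + y 1) (y 2 + y 3 ∷ ps ∷ʳ y k))
               (map-cong shift (upTo m)) (*-suc 2 (suc m)) ⟨
    fromRuns (y 0 + y 1) (y 2 + y 3 ∷ map (evenOddPair y ∘ suc) (upTo m) ∷ʳ y (2 * suc (suc m)))
      ≡⟨ cong (λ ps → fromRuns (y 0 + y 1) (ps ∷ʳ y (2 * suc (suc m)))) (map-upTo-suc (evenOddPair y) m) ⟨
    fromRuns (y 0 + y 1) (map (evenOddPair y) (upTo (suc m)) ∷ʳ y (2 * suc (suc m))) ∎
    where
    y₂ : ℕ → ℕ
    y₂ i = y (2 + i)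
    pairs₂ : List ℕ
    pairs₂ = map (evenOddPair y₂) (upTo m)
    shift : ∀ i → evenOddPair y (suc i) ≡ evenOddPair y₂ i
    shift i = cong (λ k → y (k + 2) + y (k + 3)) (*-suc 2 i)

TwinEquations : ℕ → (ℕ → ℕ) → (ℕ → ℕ) → Set
TwinEquations m x y =
    (x 0 ≡ y 0 + y 1)
  × ((i : ℕ) → 1 ≤ i → i ≤ m ∸ 1 → x (2 * i ∸ 1) + x (2 * i) ≡ y (2 * i) + y (2 * i + 1))
  × (x (2 * m ∸ 1) + x (2 * m) ≡ y (2 * m))

double-suc : ∀ i → 2 * i + 2 ≡ 2 * suc i
double-suc = solve-∀

oddEvenPair-≡ : ∀ x i → oddEvenPair x i ≡ x (2 * suc i ∸ 1) + x (2 * suc i)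
oddEvenPair-≡ x i =
  cong₂ _+_ (cong x (trans (+-comm (2 * i) 1) (cong (_∸ 1) (sym (*-suc 2 i))))) (cong x (double-suc i))

evenOddPair-≡ : ∀ y i → evenOddPair y i ≡ y (2 * suc i) + y (2 * suc i + 1)
evenOddPair-≡ y i = cong₂ _+_ (cong y (double-suc i)) (cong y (double-suc+1 i))
  where
  double-suc+1 : ∀ i → 2 * i + 3 ≡ 2 * suc i + 1
  double-suc+1 = solve-∀

rForm≡lForm⇔ : ∀ m x y → (rForm (suc m) x ≡ lForm (suc m) y) ⇔ TwinEquations (suc m) x y
rForm≡lForm⇔ m x y = mk⇔ to from
  where
  X Y : ℕ → ℕ
  X = oddEvenPair x
  Y = evenOddPair y
  pairs⇔ : map X (upTo m) ≡ map Y (upTo m) ⇔ (∀ i → i < m → X i ≡ Y i)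
  pairs⇔ = map-upTo-≡⇔ X Y m

  to : rForm (suc m) x ≡ lForm (suc m) y → TwinEquations (suc m) x y
  to eq
    with x₀≡ , pairs≡ ← fromRuns-injective _ _ _ _
                          (trans (sym (rForm-fromRuns (suc m) x)) (trans eq (lForm-fromRuns m y)))
    with inner≡ , last≡ ← ∷ʳ-injective (map X (upTo m)) _ (trans (sym (map-upTo-∷ʳ X m)) pairs≡)
    = x₀≡ , middle (Equivalence.to pairs⇔ inner≡) , trans (sym (oddEvenPair-≡ x m)) last≡
    where
    middle : (∀ i → i < m → X i ≡ Y i) →
             ∀ i → 1 ≤ i → i ≤ m → x (2 * i ∸ 1) + x (2 * i) ≡ y (2 * i) + y (2 * i + 1)
    middle X≡Y (suc i) _ i<m = trans (sym (oddEvenPair-≡ x i)) (trans (X≡Y i i<m) (evenOddPair-≡ y i))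

  from : TwinEquations (suc m) x y → rForm (suc m) x ≡ lForm (suc m) y
  from (x₀≡ , middle , last) =
    trans (rForm-fromRuns (suc m) x) (trans (cong₂ fromRuns x₀≡ pairs≡) (sym (lForm-fromRuns m y)))
    where
    X≡Y : ∀ i → i < m → X i ≡ Y i
    X≡Y i i<m = trans (oddEvenPair-≡ x i) (trans (middle (suc i) (s≤s z≤n) i<m) (sym (evenOddPair-≡ y i)))
    pairs≡ : map X (upTo (suc m)) ≡ map Y (upTo m) ∷ʳ y (2 * suc m)
    pairs≡ = trans (map-upTo-∷ʳ X m) (cong₂ _∷ʳ_ (Equivalence.from pairs⇔ X≡Y) (trans (oddEvenPair-≡ x m) last))

cancel⇔ : ∀ {a b c d} k → a ≡ c + k → b ≡ d + k → (a ≡ b) ⇔ (c ≡ d)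
cancel⇔ k a≡ b≡ = mk⇔ (λ eq → +-cancelʳ-≡ k _ _ (trans (sym a≡) (trans eq b≡)))
                      (λ eq → trans a≡ (trans (cong (_+ k) eq) (sym b≡)))

+-∸-regroup : ∀ {u A v B} → u ≤ A → v ≤ B → A + B ≡ ((A ∸ u) + (B ∸ v)) + (u + v)
+-∸-regroup {u} {A} {v} {B} u≤A v≤B =
  trans (sym (cong₂ _+_ (m+[n∸m]≡n u≤A) (m+[n∸m]≡n v≤B))) (regroup u (A ∸ u) v (B ∸ v))
  where
  regroup : ∀ u a v b → (u + a) + (v + b) ≡ (a + b) + (u + v)
  regroup = solve-∀

Bounded : ℕ → (ℕ → ℕ) → (ℕ → ℕ) → Set
Bounded n r a = ∀ i → i ≤ n → r i ≤ a i

System⇔ : ∀ m a r → System (suc m) a r ⇔ (Bounded (2 * suc m) r a × TwinEquations (suc m) r (λ i → a i ∸ r i))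
System⇔ m a r = mk⇔
  (λ (r≤a , e₀ , e , e₁) →
     r≤a , to (first r≤a) e₀ , (λ i 1≤i i≤m → to (middle r≤a i≤m) (e i 1≤i i≤m)) , to (last r≤a) e₁)
  (λ (r≤a , e₀ , e , e₁) →
     r≤a , from (first r≤a) e₀ , (λ i 1≤i i≤m → from (middle r≤a i≤m) (e i 1≤i i≤m)) , from (last r≤a) e₁)
  where
  open Equivalence
  n : ℕ
  n = 2 * suc m
  l : ℕ → ℕ
  l i = a i ∸ r i

  first : Bounded n r a → (2 * r 0 + r 1 ≡ a 0 + a 1) ⇔ (r 0 ≡ l 0 + l 1)
  first r≤a = cancel⇔ (r 0 + r 1) (regroup (r 0) (r 1)) (+-∸-regroup (r≤a 0 z≤n) (r≤a 1 (s≤s z≤n)))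
    where
    regroup : ∀ u v → 2 * u + v ≡ u + (u + v)
    regroup = solve-∀

  middle : Bounded n r a → ∀ {i} → i ≤ m →
    (2 * r (2 * i) + r (2 * i ∸ 1) + r (2 * i + 1) ≡ a (2 * i) + a (2 * i + 1)) ⇔
    (r (2 * i ∸ 1) + r (2 * i) ≡ l (2 * i) + l (2 * i + 1))
  middle r≤a {i} i≤m =
    cancel⇔ (r (2 * i) + r (2 * i + 1)) (regroup (r (2 * i)) (r (2 * i ∸ 1)) (r (2 * i + 1)))
            (+-∸-regroup (r≤a (2 * i) even≤) (r≤a (2 * i + 1) odd≤))
    where
    regroup : ∀ u p v → 2 * u + p + v ≡ (p + u) + (u + v)
    regroup = solve-∀
    even≤ : 2 * i ≤ n
    even≤ = *-monoʳ-≤ 2 (m≤n⇒m≤1+n i≤m)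
    odd≤ : 2 * i + 1 ≤ n
    odd≤ = subst₂ _≤_ (+-comm 1 (2 * i)) (sym (*-suc 2 m)) (m≤n⇒m≤1+n (s≤s (*-monoʳ-≤ 2 i≤m)))

  last : Bounded n r a → (2 * r n + r (n ∸ 1) ≡ a n) ⇔ (r (n ∸ 1) + r n ≡ l n)
  last r≤a = cancel⇔ (r n) (regroup (r n) (r (n ∸ 1))) (sym (m∸n+n≡m (r≤a n ≤-refl)))
    where
    regroup : ∀ u p → 2 * u + p ≡ (p + u) + u
    regroup = solve-∀

-- Unlike a Colouring, which is indexed by the length of its word, a list of (letter, colour) pairs
-- can be split and concatenated freely.
ColouredWord : Set
ColouredWord = List (Bit × Bool)

underlying : ColouredWord → Word
underlying = map proj₁

colouringOf : (t : ColouredWord) → Colouring (underlying t)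
colouringOf []            = []
colouringOf ((_ , c) ∷ t) = c ∷ colouringOf t

class : Bool → ColouredWord → Word
class b t = pick (underlying t) (colouringOf t) b

onesClasses : ColouredWord → List Bool
onesClasses t = onesColours (underlying t) (colouringOf t)

colour : (w : Word) → Colouring w → ColouredWord
colour []      []       = []
colour (x ∷ w) (c ∷ cs) = (x , c) ∷ colour w cs

colour-inverse : ∀ w c → _≡_ {A = Σ Word Colouring} (underlying (colour w c) , colouringOf (colour w c)) (w , c)
colour-inverse []      []       = refl
colour-inverse (x ∷ w) (c ∷ cs) = cong (λ (w′ , cs′) → x ∷ w′ , c ∷ cs′) (colour-inverse w cs)

colour-classes : ∀ w c →
  Σ ColouredWord λ t → underlying t ≡ w × (∀ b → class b t ≡ pick w c b) × onesClasses t ≡ onesColours w c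
colour-classes w c =
    colour w c , cong proj₁ inverse
  , (λ b → cong (λ (w , c) → pick w c b) inverse) , cong (λ (w , c) → onesColours w c) inverse
  where
  inverse : _≡_ {A = Σ Word Colouring} (underlying (colour w c) , colouringOf (colour w c)) (w , c)
  inverse = colour-inverse w c

colouring-classes : ∀ t {w} → underlying t ≡ w →
  Σ (Colouring w) λ c → (∀ b → pick w c b ≡ class b t) × onesColours w c ≡ onesClasses t
colouring-classes t refl = colouringOf t , (λ _ → refl) , refl

class-same : ∀ b x t → class b ((x , b) ∷ t) ≡ x ∷ class b t
class-same true  x t = refl
class-same false x t = refl

class-other : ∀ b x t → class (not b) ((x , b) ∷ t) ≡ class (not b) t
class-other true  x t = refl
class-other false x t = refl

class-other′ : ∀ b x t → class b ((x , not b) ∷ t) ≡ class b t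
class-other′ true  x t = refl
class-other′ false x t = refl

-- As far as its colour classes and the colours of its 1s can tell, t is a run of p zeros of colour s
-- and q zeros of colour not s, followed by t′.
record ZeroRun (s : Bool) (p q : ℕ) (t t′ : ColouredWord) : Set where
  field
    ones  : onesClasses t ≡ onesClasses t′
    same  : class s t ≡ zeros p ++ class s t′
    other : class (not s) t ≡ zeros q ++ class (not s) t′
open ZeroRun

zeroRun-none : ∀ {s} t → ZeroRun s 0 0 t t
zeroRun-none t = record { ones = refl ; same = refl ; other = refl }

zeroRun-same : ∀ {s p q t t′} → ZeroRun s p q t t′ → ZeroRun s (suc p) q ((𝟎 , s) ∷ t) t′
zeroRun-same {s} {t = t} run = record
  { ones  = ones run
  ; same  = trans (class-same s 𝟎 t) (cong (𝟎 ∷_) (same run))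
  ; other = trans (class-other s 𝟎 t) (other run)
  }

zeroRun-other : ∀ {s p q t t′} → ZeroRun s p q t t′ → ZeroRun s p (suc q) ((𝟎 , not s) ∷ t) t′
zeroRun-other {s} {t = t} run = record
  { ones  = ones run
  ; same  = trans (class-other′ s 𝟎 t) (same run)
  ; other = trans (class-same (not s) 𝟎 t) (cong (𝟎 ∷_) (other run))
  }

peel-zeros : ∀ s k t {rest} → underlying t ≡ zeros k ++ rest →
  Σ ℕ λ p → Σ ℕ λ q → Σ ColouredWord λ t′ → p + q ≡ k × underlying t′ ≡ rest × ZeroRun s p q t t′
peel-zeros s zero    t             eq = 0 , 0 , t , refl , eq , zeroRun-none t
peel-zeros s (suc k) ((x , c) ∷ t) eq
  with refl , eq′ ← ∷-injective eq
  with p , q , t′ , p+q≡k , e , run ← peel-zeros s k t eq′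
  with c ≟ᵇ s
... | yes refl = suc p , q , t′ , cong suc p+q≡k , e , zeroRun-same run
... | no c≢s with refl ← ¬-not c≢s = p , suc q , t′ , trans (+-suc p q) (cong suc p+q≡k) , e , zeroRun-other run

block : Bool → ℕ → ℕ → ColouredWord → ColouredWord
block s p q t = replicate p (𝟎 , s) ++ replicate q (𝟎 , not s) ++ t

block-zeroRun : ∀ s p q t → ZeroRun s p q (block s p q t) t
block-zeroRun s (suc p) q       t = zeroRun-same (block-zeroRun s p q t)
block-zeroRun s zero    (suc q) t = zeroRun-other (block-zeroRun s zero q t)
block-zeroRun s zero    zero    t = zeroRun-none t

underlying-block : ∀ s p q t → underlying (block s p q t) ≡ zeros (p + q) ++ underlying t
underlying-block s (suc p) q       t = cong (𝟎 ∷_) (underlying-block s p q t)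
underlying-block s zero    (suc q) t = cong (𝟎 ∷_) (underlying-block s zero q t)
underlying-block s zero    zero    t = refl

AlternatingFrom : Bool → List Bool → Set
AlternatingFrom s []       = ⊤
AlternatingFrom s (c ∷ cs) = c ≡ s × AlternatingFrom (not s) cs

alternatingFrom : ∀ cs → Alternating cs → Σ Bool λ s → AlternatingFrom s cs
alternatingFrom []       _   = true , tt
alternatingFrom (c ∷ cs) alt = c , from-head c cs alt
  where
  from-head : ∀ c cs → Alternating (c ∷ cs) → AlternatingFrom c (c ∷ cs)
  from-head c []       _           = refl , tt
  from-head c (d ∷ cs) (c≢d , alt) with refl ← ¬-not (c≢d ∘ sym) = refl , from-head d cs alt

alternatingFrom⇒alternating : ∀ s cs → AlternatingFrom s cs → Alternating cs
alternatingFrom⇒alternating s []           _                 = tt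
alternatingFrom⇒alternating s (_ ∷ [])     _                 = tt
alternatingFrom⇒alternating s (_ ∷ d ∷ cs) (refl , refl , alt) =
  not-¬ refl , alternatingFrom⇒alternating (not s) (d ∷ cs) (refl , alt)

Sums : ℕ → (ℕ → ℕ) → (ℕ → ℕ) → (ℕ → ℕ) → Set
Sums n x y a = ∀ i → i ≤ n → x i + y i ≡ a i

infixr 5 _◃_
_◃_ : ℕ → (ℕ → ℕ) → ℕ → ℕ
(p ◃ f) zero    = p
(p ◃ f) (suc i) = f i

sums-◃ : ∀ {n p q x y a} → p + q ≡ a 0 → Sums n x y (a ∘ suc) → Sums (suc n) (p ◃ y) (q ◃ x) a
sums-◃ p+q _    zero    _         = p+q
sums-◃ {x = x} {y} _ sums (suc i) (s≤s i≤n) = trans (+-comm (y i) (x i)) (sums i i≤n)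

sums-tail : ∀ {n x y a} → Sums (suc n) x y a → Sums n (y ∘ suc) (x ∘ suc) (a ∘ suc)
sums-tail {x = x} {y} sums i i≤n = trans (+-comm (y (suc i)) (x (suc i))) (sums (suc i) (s≤s i≤n))

record Splits (s : Bool) (n : ℕ) (x y : ℕ → ℕ) (t : ColouredWord) : Set where
  constructor _,_
  field
    X-form : class s t ≡ halfRuns true n x
    Y-form : class (not s) t ≡ halfRuns false n y
open Splits

splits-end : ∀ {s t x y} → ZeroRun s (x 0) (y 0) t [] → Splits s 0 x y t
splits-end run = trans (same run) (++-identityʳ _) , trans (other run) (++-identityʳ _)

splits-step : ∀ {s t t′ n x y} → ZeroRun s (x 0) (y 0) t ((𝟏 , s) ∷ t′) →
  Splits (not s) n (y ∘ suc) (x ∘ suc) t′ → Splits s (suc n) x y t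
splits-step {s} {t′ = t′} {n} {x} {y} run (Y-form′ , X-form′) =
    trans (same run) (cong (zeros (x 0) ++_) (trans (class-same s 𝟏 t′) (cong (𝟏 ∷_) X-form″)))
  , trans (other run) (cong (zeros (y 0) ++_) (trans (class-other s 𝟏 t′) Y-form′))
  where
  X-form″ : class s t′ ≡ halfRuns false n (x ∘ suc)
  X-form″ = subst (λ b → class b t′ ≡ _) (not-involutive s) X-form′

alternating⇒splits : ∀ n a s t → underlying t ≡ runs n a → AlternatingFrom s (onesClasses t) →
  Σ (ℕ → ℕ) λ x → Σ (ℕ → ℕ) λ y → Sums n x y a × Splits s n x y t
alternating⇒splits zero a s t eq _ with peel-zeros s (a 0) t (trans eq (sym (++-identityʳ _)))
... | p , q , []    , p+q , _  , run =
  (λ _ → p) , (λ _ → q) , (λ { zero _ → p+q ; (suc _) () }) , splits-end run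
... | _ , _ , _ ∷ _ , _   , () , _
alternating⇒splits (suc n) a s t eq alt with peel-zeros s (a 0) t eq
... | _ , _ , []            , _   , () , _
... | p , q , (x , c) ∷ t′  , p+q , e  , run
  with refl , e′ ← ∷-injective e
  with refl , alt′ ← subst (AlternatingFrom s) (ones run) alt
  with x′ , y′ , sums , splits ← alternating⇒splits n (a ∘ suc) (not s) t′ e′ alt′
  = p ◃ y′ , q ◃ x′ , sums-◃ p+q sums , splits-step run splits

splits⇒alternating : ∀ n a s x y → Sums n x y a →
  Σ ColouredWord λ t → underlying t ≡ runs n a × AlternatingFrom s (onesClasses t) × Splits s n x y t
splits⇒alternating zero a s x y sums =
    block s (x 0) (y 0) []
  , trans (underlying-block s (x 0) (y 0) []) (trans (++-identityʳ _) (cong zeros (sums 0 z≤n)))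
  , subst (AlternatingFrom s) (sym (ones run)) tt
  , splits-end run
  where
  run : ZeroRun s (x 0) (y 0) (block s (x 0) (y 0) []) []
  run = block-zeroRun s (x 0) (y 0) []
splits⇒alternating (suc n) a s x y sums
  with t′ , e , alt , splits ←
         splits⇒alternating n (a ∘ suc) (not s) (y ∘ suc) (x ∘ suc) (sums-tail {x = x} {y} sums) =
    block s (x 0) (y 0) ((𝟏 , s) ∷ t′)
  , trans (underlying-block s (x 0) (y 0) _) (cong₂ (λ k w → zeros k ++ 𝟏 ∷ w) (sums 0 z≤n) e)
  , subst (AlternatingFrom s) (sym (ones run)) (refl , alt)
  , splits-step run splits
  where
  run : ZeroRun s (x 0) (y 0) (block s (x 0) (y 0) ((𝟏 , s) ∷ t′)) ((𝟏 , s) ∷ t′)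
  run = block-zeroRun s (x 0) (y 0) ((𝟏 , s) ∷ t′)

≡-at-not : ∀ {A : Set} (f : Bool → A) → f true ≡ f false → ∀ s → f s ≡ f (not s)
≡-at-not f eq true  = eq
≡-at-not f eq false = sym eq

alternating⇒forms : ∀ m a (c : Colouring (W (suc m) a)) → Alternating (onesColours (W (suc m) a) c) →
  Σ Bool λ s → Σ (ℕ → ℕ) λ r → Bounded (2 * suc m) r a
    × pick (W (suc m) a) c s ≡ rForm (suc m) r
    × pick (W (suc m) a) c (not s) ≡ lForm (suc m) (λ i → a i ∸ r i)
alternating⇒forms m a c alt
  with t , e , class≡ , ones≡ ← colour-classes (W (suc m) a) c
  with s , alt′ ← alternatingFrom _ (subst Alternating (sym ones≡) alt)
  with x , y , sums , splits ← alternating⇒splits (2 * suc m) a s t (trans e (W-runs (suc m) a)) alt′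
  = s , x , x≤a
  , trans (sym (class≡ s)) (trans (X-form splits) (halfRuns-rForm (suc m) x))
  , trans (sym (class≡ (not s)))
          (trans (Y-form splits) (trans (halfRuns-cong false _ y≡a∸x) (halfRuns-lForm m (λ i → a i ∸ x i))))
  where
  x≤a : Bounded (2 * suc m) x a
  x≤a i i≤n = subst (x i ≤_) (sums i i≤n) (m≤m+n (x i) (y i))
  y≡a∸x : ∀ i → i ≤ 2 * suc m → y i ≡ a i ∸ x i
  y≡a∸x i i≤n = trans (sym (m+n∸m≡n (x i) (y i))) (cong (_∸ x i) (sums i i≤n))

system⇒alternating-twins : ∀ m a r → System (suc m) a r → Σ (Colouring (W (suc m) a)) λ c →
  PerfectTwins (W (suc m) a) c × Alternating (onesColours (W (suc m) a) c)
    × pick (W (suc m) a) c true ≡ rForm (suc m) r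
    × pick (W (suc m) a) c false ≡ lForm (suc m) (λ i → a i ∸ r i)
system⇒alternating-twins m a r sys
  with r≤a , eqs ← Equivalence.to (System⇔ m a r) sys
  with t , e , alt , splits ←
         splits⇒alternating (2 * suc m) a true r (λ i → a i ∸ r i) (λ i i≤n → m+[n∸m]≡n (r≤a i i≤n))
  with c , pick≡ , ones≡ ← colouring-classes t (trans e (sym (W-runs (suc m) a)))
  = c , trans X≡ (trans (Equivalence.from (rForm≡lForm⇔ m r l) eqs) (sym Y≡))
  , alternatingFrom⇒alternating true _ (subst (AlternatingFrom true) (sym ones≡) alt) , X≡ , Y≡
  where
  l : ℕ → ℕ
  l i = a i ∸ r i
  X≡ : pick (W (suc m) a) c true ≡ rForm (suc m) r
  X≡ = trans (pick≡ true) (trans (X-form splits) (halfRuns-rForm (suc m) r))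
  Y≡ : pick (W (suc m) a) c false ≡ lForm (suc m) l
  Y≡ = trans (pick≡ false) (trans (Y-form splits) (halfRuns-lForm m l))

proposition3p4 : (m : ℕ) → 2 ≤ m → (a : ℕ → ℕ)
    → ((i : ℕ) → 1 ≤ i → i ≤ 2 * m ∸ 1 → 1 ≤ a i)
    → IsEven (W m a)
    → (ShuffleSquareAlt1 (W m a) ⇔ Σ (ℕ → ℕ) (λ r → System m a r))
      × ((r : ℕ → ℕ) → System m a r →
           Σ (Colouring (W m a)) λ c →
             PerfectTwins (W m a) c
             × pick (W m a) c true ≡ rForm m r
             × pick (W m a) c false ≡ lForm m (λ i → a i ∸ r i))
proposition3p4 zero    ()
proposition3p4 (suc m) _  a _ _ = mk⇔ to from , twins
  where
  to : ShuffleSquareAlt1 (W (suc m) a) → Σ (ℕ → ℕ) (System (suc m) a)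
  to (c , c-twins , alt) with s , r , r≤a , X≡ , Y≡ ← alternating⇒forms m a c alt =
    r , Equivalence.from (System⇔ m a r) (r≤a , Equivalence.to (rForm≡lForm⇔ m r (λ i → a i ∸ r i)) X≡Y)
    where
    X≡Y : rForm (suc m) r ≡ lForm (suc m) (λ i → a i ∸ r i)
    X≡Y = trans (sym X≡) (trans (≡-at-not (pick (W (suc m) a) c) c-twins s) Y≡)
  from : Σ (ℕ → ℕ) (System (suc m) a) → ShuffleSquareAlt1 (W (suc m) a)
  from (r , sys) with c , c-twins , alt , _ ← system⇒alternating-twins m a r sys = c , c-twins , alt
  twins : (r : ℕ → ℕ) → System (suc m) a r → Σ (Colouring (W (suc m) a)) λ c →
    PerfectTwins (W (suc m) a) c × pick (W (suc m) a) c true ≡ rForm (suc m) r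
      × pick (W (suc m) a) c false ≡ lForm (suc m) (λ i → a i ∸ r i)
  twins r sys with c , c-twins , _ , X≡ , Y≡ ← system⇒alternating-twins m a r sys = c , c-twins , X≡ , Y≡
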